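{- Let $G$ be a connected graph of order $n\ge 2$. Then $\dim_2(G)=2$ if and only if $G$ is isomorphic to the path $P_n$.
   Context: For a connected graph with shortest-path distance $d$: a set $S$ of vertices is a $2$-metric generator if every pair of distinct vertices $x,y$ has at least $2$ elements $w\in S$ with $d(x,w)\ne d(y,w)$; $\dim_2(G)$ is the minimum cardinality of a $2$-metric generator for $G$. -}

module Defs where

open import Data.Nat using (ℕ; zero; suc; _≤_; _+_)
open import Data.Fin using (Fin; toℕ)
open import Data.Fin.Subset using (Subset; _∈_; ∣_∣)
open import Data.Bool using (Bool; true; false; _∨_)
open import Data.Nat using (_≡ᵇ_)
open import Data.Product using (Σ; ∃; _×_; _,_)
open import Relation.Binary.PropositionalEquality using (_≡_; _≢_; refl; cong₂)
open import Data.Bool.Properties using (∨-comm)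
open import Relation.Nullary using (¬_)
open import Function.Bundles using (Inverse)
open import Relation.Binary.PropositionalEquality using (setoid)

record Graph (n : ℕ) : Set where
  field
    adj    : Fin n → Fin n → Bool
    sym    : ∀ x y → adj x y ≡ adj y x
    irrefl : ∀ x → adj x x ≡ false
open Graph public

data Walk {n : ℕ} (G : Graph n) : Fin n → Fin n → ℕ → Set where
  here : ∀ {x} → Walk G x x zero
  step : ∀ {x y z k} → adj G x y ≡ true → Walk G y z k → Walk G x z (suc k)

Dist : {n : ℕ} → Graph n → Fin n → Fin n → ℕ → Set
Dist G x y k = Walk G x y k × (∀ m → Walk G x y m → k ≤ m)

Connected : {n : ℕ} → Graph n → Set
Connected {n} G = ∀ (x y : Fin n) → ∃ λ k → Walk G x y k

Distinguishes : {n : ℕ} → Graph n → Fin n → Fin n → Fin n → Set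
Distinguishes G w x y = ∀ k l → Dist G x w k → Dist G y w l → k ≢ l

Is2MetricGenerator : {n : ℕ} → Graph n → Subset n → Set
Is2MetricGenerator {n} G S =
  ∀ (x y : Fin n) → x ≢ y →
    Σ (Fin n) λ w₁ → Σ (Fin n) λ w₂ →
      w₁ ≢ w₂ × w₁ ∈ S × w₂ ∈ S × Distinguishes G w₁ x y × Distinguishes G w₂ x y

Dim2≡ : {n : ℕ} → Graph n → ℕ → Set
Dim2≡ {n} G k =
  (Σ (Subset n) λ S → Is2MetricGenerator G S × ∣ S ∣ ≡ k)
  × (∀ (S : Subset n) → Is2MetricGenerator G S → k ≤ ∣ S ∣)

pathAdj : {n : ℕ} → Fin n → Fin n → Bool
pathAdj i j = (suc (toℕ i) ≡ᵇ toℕ j) ∨ (suc (toℕ j) ≡ᵇ toℕ i)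

_≅_ : {n m : ℕ} → Graph n → Graph m → Set
_≅_ {n} {m} G H =
  Σ (Inverse (setoid (Fin n)) (setoid (Fin m))) λ f →
    ∀ x y → adj G x y ≡ adj H (Inverse.to f x) (Inverse.to f y)

private
  suc≡ᵇ-false : ∀ m → (suc m ≡ᵇ m) ≡ false
  suc≡ᵇ-false zero = refl
  suc≡ᵇ-false (suc m) = suc≡ᵇ-false m

Path : (n : ℕ) → Graph n
Path n = record
  { adj    = pathAdj
  ; sym    = λ x y → ∨-comm (suc (toℕ x) ≡ᵇ toℕ y) (suc (toℕ y) ≡ᵇ toℕ x)
  ; irrefl = λ x → cong₂ _∨_ (suc≡ᵇ-false (toℕ x)) (suc≡ᵇ-false (toℕ x))
  }

module Submission where

-- The key notion is a *resolving vertex*: a vertex a such that the distance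
-- d(·,a) is injective.  The proof rests on three facts.
--   (1) In a 2-metric generator with exactly two elements each element
--       distinguishes every pair, i.e. is a resolving vertex.
--   (2) A connected graph with a resolving vertex a is a path: d(·,a) is
--       injective, and its image is downward closed (a shortest walk to a
--       passes through every smaller distance), so it enumerates the
--       vertices as 0,1,…,n-1; adjacent vertices then have consecutive
--       distances and vice versa.
--   (3) Both endpoints of P_n are resolving vertices, since d(i,j) = |i-j|
--       in P_n, and resolving vertices are transported along isomorphisms;
--       two distinct resolving vertices form a 2-metric generator, and every
--       2-metric generator of a graph with two vertices has two elements.

open import Defs renaming (sym to adj-sym)
open import Data.Nat using (ℕ; _≤_)
open import Function.Bundles using (_⇔_)

open import Data.Nat using (zero; suc; _<_; _+_; _∸_; ∣_-_∣; z≤n; s≤s; _≡ᵇ_; _<?_)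
import Data.Nat as ℕ
open import Data.Nat.Properties
  using ( ≤-antisym; ≤-trans; ≤-reflexive; ≤-total; ≤-pred; <-irrefl; <-≤-trans; ≤-<-trans
        ; +-suc; +-identityʳ; m≤m+n; m+[n∸m]≡n; m∸n+n≡m; ∸-cancelˡ-≡; ≮⇒≥
        ; ∣-∣-comm; ∣-∣-triangle; ∣n-n∣≡0; ∣-∣-identityʳ; m≤n⇒∣m-n∣≡n∸m
        ; ≡ᵇ⇒≡; ≡⇒≡ᵇ )
open import Data.Fin using (Fin; toℕ; fromℕ; fromℕ<)
open import Data.Fin.Properties using (toℕ-injective; toℕ-fromℕ; toℕ-fromℕ<; toℕ<n; toℕ≤pred[n]; injective⇒≤; any?)
  renaming (_≟_ to _≟ᶠ_)
open import Data.Fin.Subset using (Subset; _∈_; ⁅_⁆; _∪_; _-_) renaming (∣_∣ to #_)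
open import Data.Fin.Subset.Properties
  using (x∈p⇒∣p-x∣<∣p∣; x∈p∧x∉q⇒x∈p─q; x≢y⇒x∉⁅y⁆; x∈⁅x⁆; x∈p∪q⁺; ∣⁅x⁆∣≡1; ∪-identityˡ; ∪-identityʳ)
open import Data.Bool using (Bool; true; _∨_; _≟_)
open import Data.Bool.Properties using (T-≡; T-∨; ⇔→≡)
open import Data.Product using (Σ; ∃; _×_; _,_; proj₁; proj₂)
open import Data.Sum using (_⊎_; inj₁; inj₂) renaming (map to ⊎-map)
open import Data.Empty using (⊥-elim)
open import Relation.Nullary using (¬_; Dec; yes; no)
open import Relation.Nullary.Decidable using (_×-dec_)
open import Relation.Binary.PropositionalEquality
  using (_≡_; _≢_; refl; sym; trans; cong; cong₂; subst; subst₂; setoid; ≢-sym)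
open import Function.Bundles using (Inverse; mk⇔; mk↔ₛ′; Equivalence)

least-witness : (P : ℕ → Set) → (∀ m → Dec (P m)) → ∀ k → P k →
                Σ ℕ λ d → P d × (∀ m → P m → d ≤ m)
least-witness P P? k pk with P? 0
... | yes p0 = 0 , p0 , λ _ _ → z≤n
least-witness P P? zero pk | no ¬p0 = ⊥-elim (¬p0 pk)
least-witness P P? (suc k) pk | no ¬p0
  with least-witness (λ m → P (suc m)) (λ m → P? (suc m)) k pk
... | d , pd , d-least = suc d , pd , least
  where
  least : ∀ m → P m → suc d ≤ m
  least zero p    = ⊥-elim (¬p0 p)
  least (suc m) p = s≤s (d-least m p)

Consecutive : ℕ → ℕ → Set
Consecutive a b = suc a ≡ b ⊎ suc b ≡ a

-- The Boolean test for consecutiveness; by definition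
-- pathAdj i j = consecutive? (toℕ i) (toℕ j).
consecutive? : ℕ → ℕ → Bool
consecutive? a b = (suc a ≡ᵇ b) ∨ (suc b ≡ᵇ a)

consecutive?-reflects : ∀ {a b} → consecutive? a b ≡ true ⇔ Consecutive a b
consecutive?-reflects {a} {b} = mk⇔ sound complete
  where
  sound : consecutive? a b ≡ true → Consecutive a b
  sound e = ⊎-map (≡ᵇ⇒≡ (suc a) b) (≡ᵇ⇒≡ (suc b) a)
                  (Equivalence.to T-∨ (Equivalence.from T-≡ e))
  complete : Consecutive a b → consecutive? a b ≡ true
  complete c = Equivalence.to T-≡
                 (Equivalence.from T-∨ (⊎-map (≡⇒≡ᵇ (suc a) b) (≡⇒≡ᵇ (suc b) a) c))

consecutive-from-bounds : ∀ {a b} → a ≤ suc b → b ≤ suc a → a ≢ b → Consecutive a b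
consecutive-from-bounds {zero}        {zero}        _       _       a≢b = ⊥-elim (a≢b refl)
consecutive-from-bounds {zero}        {suc zero}    _       _       _   = inj₁ refl
consecutive-from-bounds {zero}        {suc (suc b)} _       (s≤s ()) _
consecutive-from-bounds {suc zero}    {zero}        _       _       _   = inj₂ refl
consecutive-from-bounds {suc (suc a)} {zero}        (s≤s ()) _      _
consecutive-from-bounds {suc a}       {suc b}       (s≤s p) (s≤s q) a≢b =
  ⊎-map (cong suc) (cong suc) (consecutive-from-bounds p q (λ e → a≢b (cong suc e)))

∣n-1+n∣≡1 : ∀ a → ∣ a - suc a ∣ ≡ 1
∣n-1+n∣≡1 zero    = refl
∣n-1+n∣≡1 (suc a) = ∣n-1+n∣≡1 a

consecutive⇒∣-∣≡1 : ∀ {a b} → Consecutive a b → ∣ a - b ∣ ≡ 1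
consecutive⇒∣-∣≡1 {a} (inj₁ refl) = ∣n-1+n∣≡1 a
consecutive⇒∣-∣≡1 {b = b} (inj₂ refl) = trans (∣-∣-comm (suc b) b) (∣n-1+n∣≡1 b)

module _ {n : ℕ} where

  member-remains : ∀ {x y : Fin n} {p : Subset n} → y ∈ p → x ≢ y → y ∈ p - x
  member-remains y∈p x≢y = x∈p∧x∉q⇒x∈p─q y∈p (x≢y⇒x∉⁅y⁆ (≢-sym x≢y))

  one-member : ∀ {x : Fin n} {p : Subset n} → x ∈ p → 1 ≤ # p
  one-member x∈p = ≤-trans (s≤s z≤n) (x∈p⇒∣p-x∣<∣p∣ x∈p)

  two-members : ∀ {x y : Fin n} {p : Subset n} → x ∈ p → y ∈ p → x ≢ y → 2 ≤ # p
  two-members x∈p y∈p x≢y =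
    ≤-trans (s≤s (one-member (member-remains y∈p x≢y))) (x∈p⇒∣p-x∣<∣p∣ x∈p)

  three-members : ∀ {x y z : Fin n} {p : Subset n} → x ∈ p → y ∈ p → z ∈ p →
                  x ≢ y → x ≢ z → y ≢ z → 3 ≤ # p
  three-members x∈p y∈p z∈p x≢y x≢z y≢z =
    ≤-trans (s≤s (two-members (member-remains y∈p x≢y) (member-remains z∈p x≢z) y≢z))
            (x∈p⇒∣p-x∣<∣p∣ x∈p)

card-pair : ∀ {n} (x y : Fin n) → x ≢ y → # (⁅ x ⁆ ∪ ⁅ y ⁆) ≡ 2
card-pair Fin.zero    Fin.zero    x≢y = ⊥-elim (x≢y refl)
card-pair Fin.zero    (Fin.suc j) _   = cong suc (trans (cong #_ (∪-identityˡ ⁅ j ⁆)) (∣⁅x⁆∣≡1 j))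
card-pair (Fin.suc i) Fin.zero    _   = cong suc (trans (cong #_ (∪-identityʳ ⁅ i ⁆)) (∣⁅x⁆∣≡1 i))
card-pair (Fin.suc i) (Fin.suc j) x≢y = card-pair i j (λ e → x≢y (cong Fin.suc e))

Resolves : ∀ {n} → Graph n → Fin n → Set
Resolves {n} G a = ∀ (x y : Fin n) → x ≢ y → Distinguishes G a x y

module Walks {n : ℕ} (G : Graph n) where

  adjacent⇒distinct : ∀ {x y} → adj G x y ≡ true → x ≢ y
  adjacent⇒distinct {x} xy refl with trans (sym (irrefl G x)) xy
  ... | ()

  walk? : ∀ k x y → Dec (Walk G x y k)
  walk? zero x y with x ≟ᶠ y
  ... | yes refl = yes here
  ... | no x≢y   = no λ { here → x≢y refl }
  walk? (suc k) x y with any? (λ z → (adj G x z ≟ true) ×-dec walk? k z y)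
  ... | yes (z , xz , w) = yes (step xz w)
  ... | no ¬w            = no λ { (step xz w) → ¬w (_ , xz , w) }

  distance : Connected G → ∀ x y → Σ ℕ (Dist G x y)
  distance conn x y with conn x y
  ... | k , w = least-witness (Walk G x y) (λ m → walk? m x y) k w

  dist-unique : ∀ {x y k l} → Dist G x y k → Dist G x y l → k ≡ l
  dist-unique (wk , k-least) (wl , l-least) = ≤-antisym (k-least _ wl) (l-least _ wk)

  snoc : ∀ {x y z k} → Walk G x y k → adj G y z ≡ true → Walk G x z (suc k)
  snoc here       yz = step yz here
  snoc (step a w) yz = step a (snoc w yz)

  reverse : ∀ {x y k} → Walk G x y k → Walk G y x k
  reverse here                = here
  reverse (step {x} {y} xy w) = snoc (reverse w) (trans (adj-sym G y x) xy)

module DistanceTo {n : ℕ} (G : Graph n) (conn : Connected G) (a : Fin n) where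
  open Walks G

  depth : Fin n → ℕ
  depth x = proj₁ (distance conn x a)

  depth-dist : ∀ x → Dist G x a (depth x)
  depth-dist x = proj₂ (distance conn x a)

  depth-edge : ∀ {x y} → adj G x y ≡ true → depth x ≤ suc (depth y)
  depth-edge {x} {y} xy = proj₂ (depth-dist x) _ (step xy (proj₁ (depth-dist y)))

  descend : ∀ x k → depth x ≡ suc k → Σ (Fin n) λ z → adj G x z ≡ true × depth z ≡ k
  descend x k e with subst (Walk G x a) e (proj₁ (depth-dist x))
  ... | step {y = z} xz w = z , xz , ≤-antisym (proj₂ (depth-dist z) k w) z-far
    where
    z-far : k ≤ depth z
    z-far = ≤-pred (subst (_≤ suc (depth z)) e (depth-edge xz))

  climb-down : ∀ i j x → depth x ≡ i + j → ∃ λ z → depth z ≡ j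
  climb-down zero    j x e = x , e
  climb-down (suc i) j x e with descend x (i + j) e
  ... | z , _ , ez = climb-down i j z ez

  depth-downClosed : ∀ x j → j ≤ depth x → ∃ λ z → depth z ≡ j
  depth-downClosed x j j≤ = climb-down (depth x ∸ j) j x (sym (m∸n+n≡m j≤))

module Enumeration {n : ℕ} (f : Fin n → ℕ)
                   (f-injective : ∀ {x y} → f x ≡ f y → x ≡ y)
                   (downClosed : ∀ x j → j ≤ f x → ∃ λ z → f z ≡ j) where

  -- The values 0,…,f x are attained injectively, so f x < n.
  bounded : ∀ x → f x < n
  bounded x = injective⇒≤ {f = level} level-injective
    where
    level : Fin (suc (f x)) → Fin n
    level j = proj₁ (downClosed x (toℕ j) (≤-pred (toℕ<n j)))
    level-injective : ∀ {i j} → level i ≡ level j → i ≡ j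
    level-injective {i} {j} e = toℕ-injective
      (trans (sym (proj₂ (downClosed x (toℕ i) _)))
             (trans (cong f e) (proj₂ (downClosed x (toℕ j) _))))

  -- If j < n were missed, all values would lie below j: too few for n vertices.
  onto : ∀ (j : Fin n) → ∃ λ z → f z ≡ toℕ j
  onto j with any? (λ z → f z ℕ.≟ toℕ j)
  ... | yes hit = hit
  ... | no miss = ⊥-elim (<-irrefl refl (<-≤-trans (toℕ<n j) (injective⇒≤ {f = squeeze} squeeze-injective)))
    where
    below : ∀ z → f z < toℕ j
    below z with f z <? toℕ j
    ... | yes lt = lt
    ... | no ¬lt = ⊥-elim (miss (downClosed z (toℕ j) (≮⇒≥ ¬lt)))
    squeeze : Fin n → Fin (toℕ j)
    squeeze z = fromℕ< (below z)
    squeeze-injective : ∀ {x y} → squeeze x ≡ squeeze y → x ≡ y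
    squeeze-injective {x} {y} e = f-injective
      (trans (sym (toℕ-fromℕ< (below x))) (trans (cong toℕ e) (toℕ-fromℕ< (below y))))

  enumeration : Σ (Inverse (setoid (Fin n)) (setoid (Fin n))) λ π →
                  ∀ x → toℕ (Inverse.to π x) ≡ f x
  enumeration = mk↔ₛ′ index (λ j → proj₁ (onto j)) index-onto index-back , toℕ-index
    where
    index : Fin n → Fin n
    index x = fromℕ< (bounded x)
    toℕ-index : ∀ x → toℕ (index x) ≡ f x
    toℕ-index x = toℕ-fromℕ< (bounded x)
    index-onto : ∀ j → index (proj₁ (onto j)) ≡ j
    index-onto j = toℕ-injective (trans (toℕ-index _) (proj₂ (onto j)))
    index-back : ∀ x → proj₁ (onto (index x)) ≡ x
    index-back x = f-injective (trans (proj₂ (onto (index x))) (toℕ-index x))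

module ResolvingVertex {n : ℕ} (G : Graph n) (conn : Connected G)
                       (a : Fin n) (resolves : Resolves G a) where
  open Walks G
  open DistanceTo G conn a

  depth-injective : ∀ {x y} → depth x ≡ depth y → x ≡ y
  depth-injective {x} {y} e with x ≟ᶠ y
  ... | yes x≡y = x≡y
  ... | no x≢y  = ⊥-elim (resolves x y x≢y _ _ (depth-dist x) (depth-dist y) e)

  -- Consecutive depths force an edge: the descent from the deeper vertex
  -- lands on the only vertex of the smaller depth.
  edge-up : ∀ {x y} → suc (depth x) ≡ depth y → adj G x y ≡ true
  edge-up {x} {y} e with descend y (depth x) (sym e)
  ... | z , yz , ez = trans (adj-sym G x y) (subst (λ t → adj G y t ≡ true) (depth-injective ez) yz)

  edge⇔consecutive : ∀ {x y} → adj G x y ≡ true ⇔ Consecutive (depth x) (depth y)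
  edge⇔consecutive {x} {y} = mk⇔ edge⇒consecutive consecutive⇒edge
    where
    edge⇒consecutive : adj G x y ≡ true → Consecutive (depth x) (depth y)
    edge⇒consecutive xy = consecutive-from-bounds (depth-edge xy)
      (depth-edge (trans (adj-sym G y x) xy)) (λ e → adjacent⇒distinct xy (depth-injective e))
    consecutive⇒edge : Consecutive (depth x) (depth y) → adj G x y ≡ true
    consecutive⇒edge (inj₁ e) = edge-up e
    consecutive⇒edge (inj₂ e) = trans (adj-sym G x y) (edge-up e)

  adj-by-depth : ∀ x y → adj G x y ≡ consecutive? (depth x) (depth y)
  adj-by-depth x y = ⇔→≡ (mk⇔
    (λ xy → Equivalence.from consecutive?-reflects (Equivalence.to edge⇔consecutive xy))
    (λ c  → Equivalence.from edge⇔consecutive (Equivalence.to consecutive?-reflects c)))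

  resolving⇒path : G ≅ Path n
  resolving⇒path = proj₁ numbering , λ x y →
    trans (adj-by-depth x y) (cong₂ consecutive? (sym (proj₂ numbering x)) (sym (proj₂ numbering y)))
    where
    numbering : Σ (Inverse (setoid (Fin n)) (setoid (Fin n))) λ π → ∀ x → toℕ (Inverse.to π x) ≡ depth x
    numbering = Enumeration.enumeration depth depth-injective depth-downClosed

module Transport {n m : ℕ} {G : Graph n} {H : Graph m} (iso : G ≅ H) where
  private
    π = proj₁ iso
    preserves = proj₂ iso

  to : Fin n → Fin m
  to = Inverse.to π

  from : Fin m → Fin n
  from = Inverse.from π

  to-from : ∀ u → to (from u) ≡ u
  to-from = Inverse.strictlyInverseˡ π

  from-to : ∀ x → from (to x) ≡ x
  from-to = Inverse.strictlyInverseʳ π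

  adj-from : ∀ u v → adj G (from u) (from v) ≡ adj H u v
  adj-from u v = trans (preserves (from u) (from v)) (cong₂ (adj H) (to-from u) (to-from v))

  walk-to : ∀ {x y k} → Walk G x y k → Walk H (to x) (to y) k
  walk-to here                = here
  walk-to (step {x} {z} xz w) = step (trans (sym (preserves x z)) xz) (walk-to w)

  walk-from : ∀ {u v k} → Walk H u v k → Walk G (from u) (from v) k
  walk-from here                = here
  walk-from (step {u} {z} uz w) = step (trans (adj-from u z) uz) (walk-from w)

  dist-to : ∀ {x y k} → Dist G x y k → Dist H (to x) (to y) k
  dist-to {x} {y} (w , least) = walk-to w , λ l w′ →
    least l (subst₂ (λ u v → Walk G u v l) (from-to x) (from-to y) (walk-from w′))

  resolves-from : ∀ {c} → Resolves H c → Resolves G (from c)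
  resolves-from {c} res x y x≢y k l dk dl =
    res (to x) (to y) (λ e → x≢y (trans (sym (from-to x)) (trans (cong from e) (from-to y))))
        k l (moved dk) (moved dl)
    where
    moved : ∀ {z j} → Dist G z (from c) j → Dist H (to z) c j
    moved {z} d = subst (λ t → Dist H (to z) t _) (to-from c) (dist-to d)

module _ {n : ℕ} where
  private
    P : Graph n
    P = Path n

  walk-length-bound : ∀ {i j : Fin n} {k} → Walk P i j k → ∣ toℕ i - toℕ j ∣ ≤ k
  walk-length-bound {i} here = ≤-reflexive (∣n-n∣≡0 (toℕ i))
  walk-length-bound {i} {j} {suc k} (step {y = z} iz w) =
    ≤-trans (∣-∣-triangle (toℕ i) (toℕ z) (toℕ j))
      (subst (λ t → t + ∣ toℕ z - toℕ j ∣ ≤ suc k)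
             (sym (consecutive⇒∣-∣≡1 (Equivalence.to (consecutive?-reflects {toℕ i} {toℕ z}) iz)))
             (s≤s (walk-length-bound w)))

  ascending-walk : ∀ k (i j : Fin n) → toℕ i + k ≡ toℕ j → Walk P i j k
  ascending-walk zero i j e =
    subst (λ t → Walk P i t 0) (toℕ-injective (trans (sym (+-identityʳ _)) e)) here
  ascending-walk (suc k) i j e = step i→next (ascending-walk k next j next+k≡j)
    where
    next<n : suc (toℕ i) < n
    next<n = ≤-<-trans (subst (suc (toℕ i) ≤_) (trans (sym (+-suc (toℕ i) k)) e)
                                (s≤s (m≤m+n (toℕ i) k)))
                       (toℕ<n j)
    next : Fin n
    next = fromℕ< next<n
    i→next : adj P i next ≡ true
    i→next = Equivalence.from consecutive?-reflects (inj₁ (sym (toℕ-fromℕ< next<n)))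
    next+k≡j : toℕ next + k ≡ toℕ j
    next+k≡j = trans (cong (_+ k) (toℕ-fromℕ< next<n)) (trans (sym (+-suc (toℕ i) k)) e)

  ordered-walk : ∀ (i j : Fin n) → toℕ i ≤ toℕ j → Walk P i j ∣ toℕ i - toℕ j ∣
  ordered-walk i j i≤j =
    ascending-walk _ i j (trans (cong (toℕ i +_) (m≤n⇒∣m-n∣≡n∸m i≤j)) (m+[n∸m]≡n i≤j))

  path-dist : ∀ (i j : Fin n) → Dist P i j ∣ toℕ i - toℕ j ∣
  path-dist i j = walk , λ _ → walk-length-bound
    where
    walk : Walk P i j ∣ toℕ i - toℕ j ∣
    walk with ≤-total (toℕ i) (toℕ j)
    ... | inj₁ i≤j = ordered-walk i j i≤j
    ... | inj₂ j≤i = subst (Walk P i j) (∣-∣-comm (toℕ j) (toℕ i))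
                           (Walks.reverse P (ordered-walk j i j≤i))

  path-resolver : ∀ (c : Fin n) →
                  (∀ (i j : Fin n) → ∣ toℕ i - toℕ c ∣ ≡ ∣ toℕ j - toℕ c ∣ → i ≡ j) →
                  Resolves P c
  path-resolver c separates i j i≢j k l dk dl k≡l = i≢j (separates i j
    (trans (Walks.dist-unique P (path-dist i c) dk)
           (trans k≡l (Walks.dist-unique P dl (path-dist j c)))))

first-resolves : ∀ K → Resolves (Path (suc K)) Fin.zero
first-resolves K = path-resolver Fin.zero λ i j e →
  toℕ-injective (trans (sym (∣-∣-identityʳ (toℕ i))) (trans e (∣-∣-identityʳ (toℕ j))))

last-resolves : ∀ K → Resolves (Path (suc K)) (fromℕ K)
last-resolves K = path-resolver (fromℕ K) λ i j e →
  toℕ-injective (∸-cancelˡ-≡ (toℕ≤pred[n] i) (toℕ≤pred[n] j)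
    (trans (sym (gap i)) (trans e (gap j))))
  where
  gap : ∀ (t : Fin (suc K)) → ∣ toℕ t - toℕ (fromℕ K) ∣ ≡ K ∸ toℕ t
  gap t = trans (cong (λ s → ∣ toℕ t - s ∣) (toℕ-fromℕ K)) (m≤n⇒∣m-n∣≡n∸m (toℕ≤pred[n] t))

resolving-pair⇒generator : ∀ {n} (G : Graph n) {a b : Fin n} → a ≢ b →
                           Resolves G a → Resolves G b → Is2MetricGenerator G (⁅ a ⁆ ∪ ⁅ b ⁆)
resolving-pair⇒generator G {a} a≢b res-a res-b x y x≢y =
  _ , _ , a≢b , x∈p∪q⁺ (inj₁ (x∈⁅x⁆ _)) , x∈p∪q⁺ {p = ⁅ a ⁆} (inj₂ (x∈⁅x⁆ _))
  , res-a x y x≢y , res-b x y x≢y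

generator-size : ∀ {m} (G : Graph (suc (suc m))) (S : Subset (suc (suc m))) →
                 Is2MetricGenerator G S → 2 ≤ # S
generator-size G S gen with gen Fin.zero (Fin.suc Fin.zero) (λ ())
... | _ , _ , w₁≢w₂ , w₁∈S , w₂∈S , _ = two-members w₁∈S w₂∈S w₁≢w₂

tight-generator-resolves : ∀ {n} (G : Graph n) (S : Subset n) → Is2MetricGenerator G S →
                           # S ≡ 2 → ∀ {a} → a ∈ S → Resolves G a
tight-generator-resolves G S gen size {a} a∈S x y x≢y with gen x y x≢y
... | w₁ , w₂ , w₁≢w₂ , w₁∈S , w₂∈S , d₁ , d₂ with a ≟ᶠ w₁ | a ≟ᶠ w₂
... | yes refl | _        = d₁
... | no _     | yes refl = d₂
... | no a≢w₁  | no a≢w₂  = ⊥-elim (3≰2 (subst (3 ≤_) size (three-members a∈S w₁∈S w₂∈S a≢w₁ a≢w₂ w₁≢w₂)))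
  where
  3≰2 : ¬ (3 ≤ 2)
  3≰2 (s≤s (s≤s ()))

dim₂-two⇒path : ∀ {n} (G : Graph (suc (suc n))) → Connected G → Dim2≡ G 2 → G ≅ Path (suc (suc n))
dim₂-two⇒path G conn ((S , gen , size) , _) with gen Fin.zero (Fin.suc Fin.zero) (λ ())
... | a , _ , _ , a∈S , _ =
  ResolvingVertex.resolving⇒path G conn a (tight-generator-resolves G S gen size a∈S)

path⇒dim₂-two : ∀ {n} (G : Graph (suc (suc n))) → G ≅ Path (suc (suc n)) → Dim2≡ G 2
path⇒dim₂-two {n} G iso =
  (⁅ first ⁆ ∪ ⁅ last ⁆ , generator , card-pair first last first≢last) , generator-size G
  where
  open Transport {G = G} {H = Path (suc (suc n))} iso
  first last : Fin (suc (suc n))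
  first = from Fin.zero
  last  = from (fromℕ (suc n))
  first≢last : first ≢ last
  first≢last e with trans (sym (toℕ-fromℕ (suc n)))
                          (cong toℕ (trans (sym (to-from _)) (trans (cong to (sym e)) (to-from _))))
  ... | ()
  generator : Is2MetricGenerator G (⁅ first ⁆ ∪ ⁅ last ⁆)
  generator = resolving-pair⇒generator G first≢last
    (resolves-from (first-resolves (suc n))) (resolves-from (last-resolves (suc n)))

proposition14 : (n : ℕ) → 2 ≤ n → (G : Graph n) → Connected G →
    Dim2≡ G 2 ⇔ (G ≅ Path n)
proposition14 (suc (suc n)) (s≤s (s≤s z≤n)) G conn =
  mk⇔ (dim₂-two⇒path G conn) (path⇒dim₂-two G)
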